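{- Let $k\ge 2$ be an integer. Then the greedy representation of $k$ with respect to the sequence $F_2,F_3,F_4,\ldots=2,3,5,\ldots$ satisfies Property 1 and Property 2.
   Context: $(F_n)_{n\ge0}$ is the Fibonacci sequence with $F_0=F_1=1$, $F_{n+1}=F_n+F_{n-1}$. A representation of a positive integer $k$ with respect to $F_2,F_3,\ldots$ is a finite multiset of terms $F_j$ ($j\ge2$) summing to $k$; every integer $k\ge2$ has one, and $1$ has none. The greedy representation of $k\ge 2$ is obtained by processing the terms $F_j\le k$ in decreasing order of $j$: for the current $F_j$, take $F_j$ the largest number $q\ge0$ of times such that the remainder $r=k-qF_j$ is $0$ or at least $2$ (i.e. representable), then replace $k$ by $r$ and continue with $F_{j-1}$, until the remainder is $0$. A representation has Property 1 if it does not contain two consecutive Fibonacci numbers $F_j$ and $F_{j+1}$. It has Property 2 if no $F_j$ appears twice or more, except that $F_2=2$ or $F_3=3$ may appear twice, but not both simultaneously. -}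

module Defs where

open import Data.Nat using (ℕ; zero; suc; _+_; _*_; _∸_; _≤_; _≤?_; _≟_; _≤ᵇ_)
open import Data.Bool using (if_then_else_)
open import Data.Nat.Properties using ()
open import Data.List using (List; []; _∷_; _++_; replicate; filter; length)
open import Data.List.Membership.Propositional using (_∈_)
open import Data.Sum using (_⊎_)
open import Data.Product using (_×_)
open import Data.Empty using (⊥)
open import Relation.Nullary using (¬_; yes; no; Dec)
open import Relation.Nullary.Decidable using (_×-dec_; _⊎-dec_)
open import Relation.Binary.PropositionalEquality using (_≡_)

F : ℕ → ℕ
F zero = 1
F (suc zero) = 1
F (suc (suc n)) = F (suc n) + F n

-- a remainder is admissible if it is 0 or at least 2 (i.e. representable)
Admissible : ℕ → Set
Admissible r = (r ≡ 0) ⊎ (2 ≤ r)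

admissible? : (r : ℕ) → Dec (Admissible r)
admissible? r = (r ≟ 0) ⊎-dec (2 ≤? r)

-- largest q ≤ n such that q * f ≤ r and r ∸ q * f is admissible
-- (q = 0 always qualifies when r is admissible)
largestQ : ℕ → ℕ → ℕ → ℕ
largestQ f r zero = zero
largestQ f r (suc n) with (suc n * f ≤? r) ×-dec admissible? (r ∸ suc n * f)
... | yes _ = suc n
... | no _  = largestQ f r n

-- the number of copies of F j taken by the greedy step on remainder r
-- (q ranges over 0..r, which contains every q with q * F j ≤ r, as F j ≥ 1)
greedyQ : ℕ → ℕ → ℕ
greedyQ j r = largestQ (F j) r r

-- A representation is a multiset of terms, given as the list of the indices j
-- of the terms F j used (with repetition).
greedyFrom : (k : ℕ) → (i : ℕ) → (r : ℕ) → List ℕ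
greedyFrom k zero r = []
greedyFrom k (suc zero) r = []
greedyFrom k (suc (suc i)) r =
  if F (suc (suc i)) ≤ᵇ k
  then replicate (greedyQ (suc (suc i)) r) (suc (suc i))
         ++ greedyFrom k (suc i) (r ∸ greedyQ (suc (suc i)) r * F (suc (suc i)))
  else greedyFrom k (suc i) r

-- greedy representation of k: start from j = k (every F j ≤ k has j ≤ k)
greedy : ℕ → List ℕ
greedy k = greedyFrom k k k

mult : ℕ → List ℕ → ℕ
mult j R = length (filter (j ≟_) R)

Property1 : List ℕ → Set
Property1 R = ∀ j → 2 ≤ j → j ∈ R → suc j ∈ R → ⊥

Property2 : List ℕ → Set
Property2 R = (∀ j → 4 ≤ j → mult j R ≤ 1)
            × (mult 2 R ≤ 2) × (mult 3 R ≤ 2)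
            × ¬ ((mult 2 R ≡ 2) × (mult 3 R ≡ 2))

-- Just before F j is processed, the greedy remainder r is admissible and either r < F (1 + j)
-- or r = F (1 + j) + 1 (the case where taking F (1 + j) would have left the unrepresentable 1).
-- For j ≥ 4 this forces F j to be taken at most once, since F (1 + j) + 1 < 2 F j; and when it is
-- taken, the new remainder satisfies the same bound one index lower, so F (j - 1) is skipped.
-- Hence the indices ≥ 4 are distinct and pairwise at least two apart, and below them the greedy
-- run starts from one of 0, 2, 3, 4, 6 and contributes [], [2], [3], [2, 2] or [3, 3].
module Submission where

open import Defs
open import Data.Nat
open import Data.Nat.Properties
open import Data.Bool using (true; false; T)
open import Data.List using (List; []; _∷_; _++_; replicate; length)
open import Data.List.Properties using (filter-accept; filter-reject; filter-none; length-filter; length-replicate)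
open import Data.List.Membership.Propositional using (_∈_)
open import Data.List.Relation.Unary.All as All using (All; []; _∷_)
open import Data.List.Relation.Unary.All.Properties using (replicate⁺)
open import Data.List.Relation.Unary.Any using (here; there)
open import Data.Sum using (_⊎_; inj₁; inj₂)
open import Data.Product using (_×_; _,_; proj₁; proj₂)
open import Data.Empty using (⊥; ⊥-elim)
open import Function using (_∘_)
open import Relation.Nullary using (¬_; yes; no; Dec)
open import Relation.Nullary.Decidable using (_⊎-dec_; _×-dec_)
open import Relation.Binary.PropositionalEquality

Feasible : ℕ → ℕ → ℕ → Set
Feasible f r q = q * f ≤ r × Admissible (r ∸ q * f)

¬Admissible-1 : ¬ Admissible 1
¬Admissible-1 (inj₁ ())
¬Admissible-1 (inj₂ (s≤s ()))

largestQ≡ : ∀ {f r n q} → q ≤ n → q ≡ 0 ⊎ Feasible f r q →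
            (∀ q′ → q < q′ → q′ ≤ n → ¬ Feasible f r q′) → largestQ f r n ≡ q
largestQ≡ {n = zero} z≤n _ _ = refl
largestQ≡ {f} {r} {suc n} {q} q≤ feasible maximal
  with (suc n * f ≤? r) ×-dec admissible? (r ∸ suc n * f) | m≤n⇒m<n∨m≡n q≤
... | yes p  | inj₁ q<n  = ⊥-elim (maximal (suc n) q<n ≤-refl p)
... | yes _  | inj₂ refl = refl
... | no _   | inj₁ q<n  = largestQ≡ (m<1+n⇒m≤n q<n) feasible
                           (λ q′ q<q′ q′≤n → maximal q′ q<q′ (m≤n⇒m≤1+n q′≤n))
... | no ¬p  | inj₂ refl with feasible
...   | inj₂ p = ⊥-elim (¬p p)

¬Feasible-≥2 : ∀ f {r} q → r < f + f → 2 ≤ q → ¬ Feasible f r q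
¬Feasible-≥2 f (suc (suc m)) r<2f _ (qf≤r , _) =
  <⇒≱ r<2f (≤-trans (+-monoʳ-≤ f (m≤m+n f (m * f))) qf≤r)
¬Feasible-≥2 _ 1 _ (s≤s ()) _

largestQ≡0 : ∀ {f r n} → 2 ≤ f → r < f ⊎ r ≡ suc f → largestQ f r n ≡ 0
largestQ≡0 {f} {r} {n} 2≤f (inj₁ r<f) = largestQ≡ z≤n (inj₁ refl) infeasible
  where
  infeasible : ∀ q → 0 < q → q ≤ n → ¬ Feasible f r q
  infeasible (suc q) _ _ (qf≤r , _) = <⇒≱ r<f (≤-trans (m≤m+n f (q * f)) qf≤r)
largestQ≡0 {f} {n = n} 2≤f (inj₂ refl) = largestQ≡ z≤n (inj₁ refl) infeasible
  where
  infeasible : ∀ q → 0 < q → q ≤ n → ¬ Feasible f (suc f) q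
  infeasible 1 _ _ (_ , adm) rewrite *-identityˡ f =
    ¬Admissible-1 (subst Admissible (m+n∸n≡m 1 f) adm)
  infeasible q@(suc (suc _)) _ _ =
    ¬Feasible-≥2 f q (subst (_≤ f + f) (+-comm f 2) (+-monoʳ-≤ f 2≤f)) (s≤s (s≤s z≤n))

largestQ≡1 : ∀ {f r n} → f ≤ r → r < f + f → Admissible (r ∸ f) → 1 ≤ n → largestQ f r n ≡ 1
largestQ≡1 {f} {r} {n} f≤r r<2f adm 1≤n = largestQ≡ 1≤n (inj₂ feasible) infeasible
  where
  feasible : Feasible f r 1
  feasible rewrite *-identityˡ f = f≤r , adm
  infeasible : ∀ q → 1 < q → q ≤ n → ¬ Feasible f r q
  infeasible q 1<q _ = ¬Feasible-≥2 f q r<2f 1<q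

1≤F : ∀ n → 1 ≤ F n
1≤F zero = s≤s z≤n
1≤F (suc zero) = s≤s z≤n
1≤F (suc (suc n)) = ≤-trans (1≤F (suc n)) (m≤m+n (F (suc n)) (F n))

2≤F[2+n] : ∀ n → 2 ≤ F (suc (suc n))
2≤F[2+n] n = +-mono-≤ (1≤F (suc n)) (1≤F n)

n<F[1+n] : ∀ n → n < F (suc n)
n<F[1+n] zero = s≤s z≤n
n<F[1+n] (suc n) = subst (_≤ F (suc (suc n))) (+-comm (suc n) 1) (+-mono-≤ (n<F[1+n] n) (1≤F n))

-- greedyFrom without the test F j ≤ k, which is vacuous while the remainder is at most k.
greedy′ : ℕ → ℕ → List ℕ
greedy′ zero r = []
greedy′ (suc zero) r = []
greedy′ (suc (suc i)) r = replicate q (suc (suc i)) ++ greedy′ (suc i) (r ∸ q * F (suc (suc i)))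
  where q = greedyQ (suc (suc i)) r

Below : ℕ → ℕ → Set
Below j r = r < F j ⊎ r ≡ suc (F j)

below? : ∀ j r → Dec (Below j r)
below? j r = (r <? F j) ⊎-dec (r ≟ suc (F j))

greedy′-skip : ∀ {i r} → Below (suc (suc i)) r → greedy′ (suc (suc i)) r ≡ greedy′ (suc i) r
greedy′-skip {i} {r} below rewrite largestQ≡0 {n = r} (2≤F[2+n] i) below = refl

greedy′-take : ∀ {i r} → greedyQ (suc (suc i)) r ≡ 1 →
               greedy′ (suc (suc i)) r ≡ suc (suc i) ∷ greedy′ (suc i) (r ∸ F (suc (suc i)))
greedy′-take {i} q≡1 rewrite q≡1 | *-identityˡ (F (suc (suc i))) = refl

≤ᵇ≡false⇒> : ∀ {m n} → (m ≤ᵇ n) ≡ false → n < m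
≤ᵇ≡false⇒> m≰ᵇn = ≰⇒> (λ m≤n → subst T m≰ᵇn (≤⇒≤ᵇ m≤n))

greedyFrom-step : ∀ {k} i → (∀ {r} → r ≤ k → greedyFrom k (suc i) r ≡ greedy′ (suc i) r) →
                  ∀ {r} → r ≤ k → greedyFrom k (suc (suc i)) r ≡ greedy′ (suc (suc i)) r
greedyFrom-step {k} i ih {r} r≤k with F (suc (suc i)) ≤ᵇ k in Fj≤ᵇk
... | true  = cong (_ ++_) (ih (≤-trans (m∸n≤m r (greedyQ (suc (suc i)) r * F (suc (suc i)))) r≤k))
... | false = trans (ih r≤k) (sym (greedy′-skip (inj₁ (≤-trans (s≤s r≤k) (≤ᵇ≡false⇒> Fj≤ᵇk)))))

greedyFrom≡greedy′ : ∀ j {k r} → r ≤ k → greedyFrom k j r ≡ greedy′ j r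
greedyFrom≡greedy′ zero _ = refl
greedyFrom≡greedy′ (suc zero) _ = refl
greedyFrom≡greedy′ (suc (suc i)) = greedyFrom-step i (greedyFrom≡greedy′ (suc i))

remainder-below : ∀ {a b r} → a ≤ r → r ≢ suc a → r < a + b ⊎ r ≡ suc (a + b) →
                  Admissible (r ∸ a) × (r ∸ a < b ⊎ r ∸ a ≡ suc b)
remainder-below {a} {b} {r} a≤r r≢1+a below with r ∸ a | m+[n∸m]≡n a≤r
... | d | refl = admissible d r≢1+a , below′ below
  where
  admissible : ∀ d → a + d ≢ suc a → Admissible d
  admissible zero _ = inj₁ refl
  admissible (suc zero) a+1≢1+a = ⊥-elim (a+1≢1+a (+-comm a 1))
  admissible (suc (suc d)) _ = inj₂ (s≤s (s≤s z≤n))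
  below′ : a + d < a + b ⊎ a + d ≡ suc (a + b) → d < b ⊎ d ≡ suc b
  below′ (inj₁ a+d<a+b) = inj₁ (+-cancelˡ-< a d b a+d<a+b)
  below′ (inj₂ a+d≡1+a+b) = inj₂ (+-cancelˡ-≡ a d (suc b) (trans a+d≡1+a+b (sym (+-suc a b))))

below-double : ∀ {a b r} → suc b < a → r < a + b ⊎ r ≡ suc (a + b) → r < a + a
below-double {a} {b} 1+b<a (inj₁ r<a+b) = <-≤-trans r<a+b (+-monoʳ-≤ a (≤-trans (n≤1+n b) (<⇒≤ 1+b<a)))
below-double {a} {b} 1+b<a (inj₂ refl) =
  subst (_≤ a + a) (trans (+-suc a (suc b)) (cong suc (+-suc a b))) (+-monoʳ-≤ a 1+b<a)

Fits : ℕ → ℕ → Set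
Fits j r = Admissible r × Below (suc j) r

greedy′-take-once : ∀ {i r} → Fits (4 + i) r → ¬ Below (4 + i) r →
                    greedy′ (4 + i) r ≡ 4 + i ∷ greedy′ (2 + i) (r ∸ F (4 + i))
                    × Fits (2 + i) (r ∸ F (4 + i))
greedy′-take-once {i} {r} (adm , below) ¬below = greedy′-unfold , fits
  where
  a≤r : F (4 + i) ≤ r
  a≤r = ≮⇒≥ (¬below ∘ inj₁)
  fits : Fits (2 + i) (r ∸ F (4 + i))
  fits = remainder-below a≤r (¬below ∘ inj₂) below
  1+b<a : suc (F (3 + i)) < F (4 + i)
  1+b<a = subst (_≤ F (4 + i)) (+-comm (F (3 + i)) 2) (+-monoʳ-≤ (F (3 + i)) (2≤F[2+n] i))
  takes-once : greedyQ (4 + i) r ≡ 1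
  takes-once = largestQ≡1 a≤r (below-double 1+b<a below) (proj₁ fits) (≤-trans (1≤F (4 + i)) a≤r)
  open ≡-Reasoning
  greedy′-unfold : greedy′ (4 + i) r ≡ 4 + i ∷ greedy′ (2 + i) (r ∸ F (4 + i))
  greedy′-unfold = begin
    greedy′ (4 + i) r                            ≡⟨ greedy′-take takes-once ⟩
    4 + i ∷ greedy′ (3 + i) (r ∸ F (4 + i))      ≡⟨ cong (4 + i ∷_) (greedy′-skip (proj₂ fits)) ⟩
    4 + i ∷ greedy′ (2 + i) (r ∸ F (4 + i))      ∎

mult-∷-≡ : ∀ x L → mult x (x ∷ L) ≡ suc (mult x L)
mult-∷-≡ x L = cong length (filter-accept (x ≟_) refl)

mult-∷-≢ : ∀ {x} y L → x ≢ y → mult x (y ∷ L) ≡ mult x L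
mult-∷-≢ {x} _ L x≢y = cong length (filter-reject (x ≟_) x≢y)

mult-none : ∀ {x L} → All (x ≢_) L → mult x L ≡ 0
mult-none {x} none = cong length (filter-none (x ≟_) none)

mult-above : ∀ {j x L} → All (_≤ j) L → j < x → mult x L ≡ 0
mult-above bounded j<x =
  mult-none (All.map (λ y≤j x≡y → <⇒≱ j<x (subst (_≤ _) (sym x≡y) y≤j)) bounded)

mult-replicate-≤ : ∀ x n c → mult x (replicate n c) ≤ n
mult-replicate-≤ x n c =
  subst (mult x (replicate n c) ≤_) (length-replicate n) (length-filter (x ≟_) (replicate n c))

Valid : ℕ → List ℕ → Set
Valid j L = All (_≤ j) L × Property1 L × Property2 L

Valid-weaken : ∀ {j m L} → j ≤ m → Valid j L → Valid m L
Valid-weaken j≤m (bounded , p1 , p2) = All.map (λ y≤j → ≤-trans y≤j j≤m) bounded , p1 , p2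

replicate-valid : ∀ {m} n c → c ≤ m → m ≤ 3 → n ≤ 2 → Valid m (replicate n c)
replicate-valid {m} n c c≤m m≤3 n≤2 = bounded , p1 , high , low 2 , low 3 , ¬both
  where
  bounded : All (_≤ m) (replicate n c)
  bounded = replicate⁺ n c≤m
  constant : ∀ {x} → x ∈ replicate n c → x ≡ c
  constant = All.lookup (replicate⁺ {P = _≡ c} n refl)
  p1 : Property1 (replicate n c)
  p1 j _ j∈ 1+j∈ = 1+n≢n (trans (constant 1+j∈) (sym (constant j∈)))
  high : ∀ x → 4 ≤ x → mult x (replicate n c) ≤ 1
  high x 4≤x = subst (_≤ 1) (sym (mult-above bounded (≤-trans (s≤s m≤3) 4≤x))) z≤n
  low : ∀ x → mult x (replicate n c) ≤ 2
  low x = ≤-trans (mult-replicate-≤ x n c) n≤2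
  absent : ∀ {x} → x ≢ c → mult x (replicate n c) ≡ 0
  absent x≢c = mult-none (replicate⁺ n x≢c)
  ¬both : ¬ (mult 2 (replicate n c) ≡ 2 × mult 3 (replicate n c) ≡ 2)
  ¬both (two , three) with c ≟ 2
  ... | yes refl = 0≢1+n (trans (sym (absent (λ ()))) three)
  ... | no c≢2   = 0≢1+n (trans (sym (absent (c≢2 ∘ sym))) two)

Valid-∷ : ∀ {i L} → Valid (2 + i) L → Valid (4 + i) (4 + i ∷ L)
Valid-∷ {i} {L} (bounded , p1 , high , two , three , ¬both) =
  (≤-refl ∷ All.map (λ y≤j → ≤-trans y≤j (m≤n+m (2 + i) 2)) bounded) ,
  p1′ , high′ , two′ , three′ , ¬both′
  where
  j = 4 + i
  j∉L : ∀ {x} → suc (suc (suc i)) ≤ x → x ∈ L → ⊥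
  j∉L 3+i≤x x∈ = <⇒≱ 3+i≤x (All.lookup bounded x∈)
  p1′ : Property1 (j ∷ L)
  p1′ x _ (here refl) (here 1+j≡j) = 1+n≢n 1+j≡j
  p1′ x _ (here refl) (there 1+j∈) = j∉L (m≤n+m _ 2) 1+j∈
  p1′ x _ (there x∈) (here refl) = j∉L ≤-refl x∈
  p1′ x 2≤x (there x∈) (there 1+x∈) = p1 x 2≤x x∈ 1+x∈
  high′ : ∀ x → 4 ≤ x → mult x (j ∷ L) ≤ 1
  high′ x 4≤x with x ≟ j
  ... | yes refl =
    ≤-reflexive (trans (mult-∷-≡ j L) (cong suc (mult-above bounded (m<n+m (2 + i) {2} z<s))))
  ... | no x≢j   = subst (_≤ 1) (sym (mult-∷-≢ j L x≢j)) (high x 4≤x)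
  two′ : mult 2 (j ∷ L) ≤ 2
  two′ = subst (_≤ 2) (sym (mult-∷-≢ j L λ ())) two
  three′ : mult 3 (j ∷ L) ≤ 2
  three′ = subst (_≤ 2) (sym (mult-∷-≢ j L λ ())) three
  ¬both′ : ¬ (mult 2 (j ∷ L) ≡ 2 × mult 3 (j ∷ L) ≡ 2)
  ¬both′ (two≡ , three≡) =
    ¬both (trans (sym (mult-∷-≢ j L λ ())) two≡ , trans (sym (mult-∷-≢ j L λ ())) three≡)

[]-valid : ∀ j → Valid j []
[]-valid j = [] , (λ _ _ ()) , (λ _ _ → z≤n) , z≤n , z≤n , λ ()

GreedyValid : ℕ → Set
GreedyValid j = ∀ r → Fits j r → Valid j (greedy′ j r)

greedy′-valid-step : ∀ {i} → GreedyValid (3 + i) → GreedyValid (2 + i) → GreedyValid (4 + i)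
greedy′-valid-step {i} valid₃ valid₂ r fits@(adm , _) with below? (4 + i) r
... | yes below = subst (Valid (4 + i)) (sym (greedy′-skip below))
                    (Valid-weaken (n≤1+n _) (valid₃ r (adm , below)))
... | no ¬below = let (unfold , fits′) = greedy′-take-once fits ¬below in
                  subst (Valid (4 + i)) (sym unfold) (Valid-∷ (valid₂ _ fits′))

greedy′-valid : ∀ j → GreedyValid j
greedy′-valid 0 _ _ = []-valid 0
greedy′-valid 1 _ _ = []-valid 1
greedy′-valid 2 0 _ = replicate-valid 0 2 ≤-refl (n≤1+n 2) z≤n
greedy′-valid 2 2 _ = replicate-valid 1 2 ≤-refl (n≤1+n 2) (s≤s z≤n)
greedy′-valid 2 4 _ = replicate-valid 2 2 ≤-refl (n≤1+n 2) ≤-refl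
greedy′-valid 3 0 _ = replicate-valid 0 2 (n≤1+n 2) ≤-refl z≤n
greedy′-valid 3 2 _ = replicate-valid 1 2 (n≤1+n 2) ≤-refl (s≤s z≤n)
greedy′-valid 3 3 _ = replicate-valid 1 3 ≤-refl ≤-refl (s≤s z≤n)
greedy′-valid 3 4 _ = replicate-valid 2 2 (n≤1+n 2) ≤-refl ≤-refl
greedy′-valid 3 6 _ = replicate-valid 2 3 ≤-refl ≤-refl ≤-refl
greedy′-valid (suc (suc (suc (suc i)))) =
  greedy′-valid-step (greedy′-valid (suc (suc (suc i)))) (greedy′-valid (suc (suc i)))
greedy′-valid _ 1 (adm , _) = ⊥-elim (¬Admissible-1 adm)
greedy′-valid 2 3 (_ , inj₁ (s≤s (s≤s (s≤s ()))))
greedy′-valid 2 3 (_ , inj₂ ())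
greedy′-valid 2 (suc (suc (suc (suc (suc r))))) (_ , inj₁ (s≤s (s≤s (s≤s ()))))
greedy′-valid 2 (suc (suc (suc (suc (suc r))))) (_ , inj₂ ())
greedy′-valid 3 5 (_ , inj₁ (s≤s (s≤s (s≤s (s≤s (s≤s ()))))))
greedy′-valid 3 5 (_ , inj₂ ())
greedy′-valid 3 (suc (suc (suc (suc (suc (suc (suc r))))))) (_ , inj₁ (s≤s (s≤s (s≤s (s≤s (s≤s ()))))))
greedy′-valid 3 (suc (suc (suc (suc (suc (suc (suc r))))))) (_ , inj₂ ())

lemma5 : (k : ℕ) → 2 ≤ k → Property1 (greedy k) × Property2 (greedy k)
lemma5 k 2≤k =
  let (_ , p1 , p2) = greedy′-valid k k (inj₂ 2≤k , inj₁ (n<F[1+n] k))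
  in subst Property1 (sym greedy≡) p1 , subst Property2 (sym greedy≡) p2
  where
  greedy≡ : greedy k ≡ greedy′ k k
  greedy≡ = greedyFrom≡greedy′ k ≤-refl
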